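{- Let $F$ be a DeMorgan circuit computing a Boolean function $f:\{0,1\}^n\to\{0,1\}$, and let $\epsilon\in\{0,1\}$. If $F$ has an $\epsilon$-hazard, then $F$ has an $\epsilon$-hazard at some prime $\epsilon$-witness of $f$.
   Context: A DeMorgan circuit has fan-in-2 AND/OR gates and inputs $0,1,x_i,\bar x_i$. Ternary logic on $\{0,\mathfrak u,1\}$ ($\mathfrak u=1/2$): AND $=\min$, OR $=\max$, NOT $=1-x$. $S_\alpha$ is the set of Boolean vectors obtained from $\alpha\in\{0,\mathfrak u,1\}^n$ by replacing each $\mathfrak u$ by $0$ or $1$. $F$ has an $\epsilon$-hazard at $\alpha$ if $F(a)=\epsilon$ for all $a\in S_\alpha$ but $F(\alpha)=\mathfrak u$. With $x_i^1=x_i$, $x_i^0=\bar x_i$, define $t_\alpha=\bigwedge_{i:\alpha_i\ne\mathfrak u}x_i^{\alpha_i}$ and $c_\alpha=\bigvee_{i:\alpha_i\ne\mathfrak u}x_i^{1-\alpha_i}$. $\alpha$ is a prime $1$-witness of $f$ if $t_\alpha$ is a prime implicant of $f$ (i.e., $t_\alpha\le f$ and no proper subterm of $t_\alpha$ is $\le f$), and a prime $0$-witness if $c_\alpha$ is a prime implicate of $f$ (i.e., $f\le c_\alpha$ and no proper subclause of $c_\alpha$ is $\ge f$). -}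

module Defs where

open import Data.Nat using (ℕ)
open import Data.Fin using (Fin)
open import Data.Bool using (Bool; true; false; not; _∧_; _∨_)
open import Data.Product using (Σ; _×_)
open import Relation.Binary.PropositionalEquality using (_≡_; _≢_)
open import Relation.Nullary using (¬_)

-- Ternary values {0, u, 1} with order 0 < u < 1
data T : Set where
  T0 Tu T1 : T

-- AND = min, OR = max, NOT = 1 - x
tand : T → T → T
tand T0 _  = T0
tand T1 y  = y
tand Tu T0 = T0
tand Tu Tu = Tu
tand Tu T1 = Tu

tor : T → T → T
tor T1 _  = T1
tor T0 y  = y
tor Tu T0 = Tu
tor Tu Tu = Tu
tor Tu T1 = T1

tnot : T → T
tnot T0 = T1
tnot Tu = Tu
tnot T1 = T0

embed : Bool → T
embed false = T0
embed true  = T1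

data Circuit (n : ℕ) : Set where
  c0 c1  : Circuit n
  var    : Fin n → Circuit n
  nvar   : Fin n → Circuit n
  and    : Circuit n → Circuit n → Circuit n
  or     : Circuit n → Circuit n → Circuit n

evalB : ∀ {n} → Circuit n → (Fin n → Bool) → Bool
evalB c0 a = false
evalB c1 a = true
evalB (var i) a = a i
evalB (nvar i) a = not (a i)
evalB (and F G) a = evalB F a ∧ evalB G a
evalB (or F G) a = evalB F a ∨ evalB G a

evalT : ∀ {n} → Circuit n → (Fin n → T) → T
evalT c0 α = T0
evalT c1 α = T1
evalT (var i) α = α i
evalT (nvar i) α = tnot (α i)
evalT (and F G) α = tand (evalT F α) (evalT G α)
evalT (or F G) α = tor (evalT F α) (evalT G α)

Computes : ∀ {n} → Circuit n → ((Fin n → Bool) → Bool) → Set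
Computes F f = ∀ a → evalB F a ≡ f a

InS : ∀ {n} → (Fin n → Bool) → (Fin n → T) → Set
InS a α = ∀ i → α i ≢ Tu → embed (a i) ≡ α i

HazardAt : ∀ {n} → Circuit n → Bool → (Fin n → T) → Set
HazardAt F ε α = (∀ a → InS a α → evalB F a ≡ ε) × evalT F α ≡ Tu

HasHazard : ∀ {n} → Circuit n → Bool → Set
HasHazard {n} F ε = Σ (Fin n → T) λ α → HazardAt F ε α

-- Terms / clauses are encoded by partial assignments β : Fin n → T:
-- t_β = ⋀_{β i ≠ u} x_i^{β i},  c_β = ⋁_{β i ≠ u} x_i^{1 - β i}.

termLit : T → Bool → Bool
termLit T1 b = b
termLit T0 b = not b
termLit Tu b = true

clauseLit : T → Bool → Bool
clauseLit T1 b = not b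
clauseLit T0 b = b
clauseLit Tu b = false

termTrue : ∀ {n} → (Fin n → T) → (Fin n → Bool) → Set
termTrue β a = ∀ i → termLit (β i) (a i) ≡ true

clauseTrue : ∀ {n} → (Fin n → T) → (Fin n → Bool) → Set
clauseTrue {n} β a = Σ (Fin n) λ i → clauseLit (β i) (a i) ≡ true

TermImplies : ∀ {n} → (Fin n → T) → ((Fin n → Bool) → Bool) → Set
TermImplies β f = ∀ a → termTrue β a → f a ≡ true

ImpliesClause : ∀ {n} → ((Fin n → Bool) → Bool) → (Fin n → T) → Set
ImpliesClause f β = ∀ a → f a ≡ true → clauseTrue β a

ProperSub : ∀ {n} → (Fin n → T) → (Fin n → T) → Set
ProperSub {n} β α =
  (∀ i → β i ≢ Tu → β i ≡ α i) × Σ (Fin n) λ i → (β i ≡ Tu × α i ≢ Tu)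

Prime1Witness : ∀ {n} → ((Fin n → Bool) → Bool) → (Fin n → T) → Set
Prime1Witness f α =
  TermImplies α f × (∀ β → ProperSub β α → ¬ TermImplies β f)

Prime0Witness : ∀ {n} → ((Fin n → Bool) → Bool) → (Fin n → T) → Set
Prime0Witness f α =
  ImpliesClause f α × (∀ β → ProperSub β α → ¬ ImpliesClause f β)

PrimeWitness : ∀ {n} → Bool → ((Fin n → Bool) → Bool) → (Fin n → T) → Set
PrimeWitness true  f α = Prime1Witness f α
PrimeWitness false f α = Prime0Witness f α

-- Being constant ε on the subcube S_β is preserved when β is made more
-- defined, so starting from a hazard α we may greedily forget literals of α as
-- long as F stays constant ε on the subcube. The result β is minimal, and for
-- such β "F is constant ε on S_β" says exactly that t_β is an implicant
-- (ε = 1), resp. c_β an implicate (ε = 0), of f; minimality makes it prime.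
-- Kleene evaluation is monotone in the information order u ≼ 0, 1, so β ⊑ α
-- and F(α) = u force F(β) = u: the hazard survives at β.
module Submission where

open import Defs
open import Data.Nat using (ℕ)
open import Data.Fin using (Fin; _≟_)
open import Data.Fin.Properties using (all?; ¬∀⟶∃¬)
open import Data.Fin.Subset.Properties using (anySubset?)
open import Data.Bool using (Bool; true; false; not; _∧_; _∨_)
open import Data.Bool.Properties using (not-involutive; ¬-not; not-¬) renaming (_≟_ to _≟ᵇ_)
open import Data.Vec using (lookup; tabulate)
open import Data.Vec.Properties using (lookup∘tabulate)
open import Data.Vec.Functional using (updateAt)
open import Data.Vec.Functional.Properties using (updateAt-updates; updateAt-minimal)
open import Data.Product using (Σ; _×_; _,_)
open import Data.List using (List; []; _∷_; allFin)
open import Data.List.Relation.Unary.All using (All; []; _∷_) renaming (lookup to All-lookup)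
open import Data.List.Membership.Propositional.Properties using (∈-allFin)
open import Function using (_∘_; const)
open import Function.Bundles using (_⇔_; mk⇔; Equivalence)
open import Relation.Nullary using (¬_; Dec; yes; no; contradiction)
open import Relation.Nullary.Decidable using (map′; decidable-stable; ¬?; _×-dec_)
open import Relation.Binary.PropositionalEquality
  using (_≡_; _≢_; _≗_; refl; sym; trans; cong; cong₂; subst)

data _≼_ : T → T → Set where
  u≼ : ∀ {x} → Tu ≼ x
  ≼-refl : ∀ {x} → x ≼ x

≼-trans : ∀ {x y z} → x ≼ y → y ≼ z → x ≼ z
≼-trans u≼ _ = u≼
≼-trans ≼-refl q = q

≼Tu⇒≡Tu : ∀ {x} → x ≼ Tu → x ≡ Tu
≼Tu⇒≡Tu u≼ = refl
≼Tu⇒≡Tu ≼-refl = refl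

tnot-mono : ∀ {x y} → x ≼ y → tnot x ≼ tnot y
tnot-mono u≼ = u≼
tnot-mono ≼-refl = ≼-refl

tand-monoˡ : ∀ {x x'} y → x ≼ x' → tand x y ≼ tand x' y
tand-monoˡ _ ≼-refl = ≼-refl
tand-monoˡ {x' = T0} T0 u≼ = ≼-refl
tand-monoˡ {x' = Tu} T0 u≼ = ≼-refl
tand-monoˡ {x' = T1} T0 u≼ = ≼-refl
tand-monoˡ Tu u≼ = u≼
tand-monoˡ T1 u≼ = u≼

tand-monoʳ : ∀ x {y y'} → y ≼ y' → tand x y ≼ tand x y'
tand-monoʳ _ ≼-refl = ≼-refl
tand-monoʳ T0 u≼ = ≼-refl
tand-monoʳ Tu u≼ = u≼
tand-monoʳ T1 u≼ = u≼

tand-mono : ∀ {x x' y y'} → x ≼ x' → y ≼ y' → tand x y ≼ tand x' y'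
tand-mono {x' = x'} {y = y} p q = ≼-trans (tand-monoˡ y p) (tand-monoʳ x' q)

tor-monoˡ : ∀ {x x'} y → x ≼ x' → tor x y ≼ tor x' y
tor-monoˡ _ ≼-refl = ≼-refl
tor-monoˡ {x' = T0} T1 u≼ = ≼-refl
tor-monoˡ {x' = Tu} T1 u≼ = ≼-refl
tor-monoˡ {x' = T1} T1 u≼ = ≼-refl
tor-monoˡ Tu u≼ = u≼
tor-monoˡ T0 u≼ = u≼

tor-monoʳ : ∀ x {y y'} → y ≼ y' → tor x y ≼ tor x y'
tor-monoʳ _ ≼-refl = ≼-refl
tor-monoʳ T1 u≼ = ≼-refl
tor-monoʳ Tu u≼ = u≼
tor-monoʳ T0 u≼ = u≼

tor-mono : ∀ {x x' y y'} → x ≼ x' → y ≼ y' → tor x y ≼ tor x' y'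
tor-mono {x' = x'} {y = y} p q = ≼-trans (tor-monoˡ y p) (tor-monoʳ x' q)

evalT-mono : ∀ {n} (F : Circuit n) {β α : Fin n → T} →
             (∀ i → β i ≼ α i) → evalT F β ≼ evalT F α
evalT-mono c0 p = ≼-refl
evalT-mono c1 p = ≼-refl
evalT-mono (var i) p = p i
evalT-mono (nvar i) p = tnot-mono (p i)
evalT-mono (and F G) p = tand-mono (evalT-mono F p) (evalT-mono G p)
evalT-mono (or F G) p = tor-mono (evalT-mono F p) (evalT-mono G p)

evalB-cong : ∀ {n} (F : Circuit n) {a b} → a ≗ b → evalB F a ≡ evalB F b
evalB-cong c0 a≗b = refl
evalB-cong c1 a≗b = refl
evalB-cong (var i) a≗b = a≗b i
evalB-cong (nvar i) a≗b = cong not (a≗b i)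
evalB-cong (and F G) a≗b = cong₂ _∧_ (evalB-cong F a≗b) (evalB-cong G a≗b)
evalB-cong (or F G) a≗b = cong₂ _∨_ (evalB-cong F a≗b) (evalB-cong G a≗b)

module _ {n : ℕ} where

  _⊑_ : (Fin n → T) → (Fin n → T) → Set
  β ⊑ α = ∀ i → β i ≢ Tu → β i ≡ α i

  ⊑-refl : ∀ {α} → α ⊑ α
  ⊑-refl _ _ = refl

  ⊑-trans : ∀ {γ β α} → γ ⊑ β → β ⊑ α → γ ⊑ α
  ⊑-trans γ⊑β β⊑α i γi≢u = trans (γ⊑β i γi≢u) (β⊑α i (γi≢u ∘ trans (γ⊑β i γi≢u)))

  ⊑⇒≼ : ∀ {β α} → β ⊑ α → ∀ i → β i ≼ α i
  ⊑⇒≼ {β} β⊑α i with β i | β⊑α i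
  ... | T0 | agree = subst (T0 ≼_) (agree λ ()) ≼-refl
  ... | Tu | _ = u≼
  ... | T1 | agree = subst (T1 ≼_) (agree λ ()) ≼-refl

  forget : Fin n → (Fin n → T) → Fin n → T
  forget j γ = updateAt γ j (const Tu)

  forget-self : ∀ j γ → forget j γ j ≡ Tu
  forget-self j γ = updateAt-updates j γ

  forget-⊑ : ∀ j γ → forget j γ ⊑ γ
  forget-⊑ j γ i ne with i ≟ j
  ... | yes refl = contradiction (forget-self j γ) ne
  ... | no i≢j = updateAt-minimal i j γ i≢j

  ⊑-forget : ∀ {β γ} j → β ⊑ γ → β j ≡ Tu → β ⊑ forget j γ
  ⊑-forget {γ = γ} j β⊑γ βj≡u i ne with i ≟ j
  ... | yes refl = contradiction βj≡u ne
  ... | no i≢j = trans (β⊑γ i ne) (sym (updateAt-minimal i j γ i≢j))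

  forget-mono : ∀ {β γ} j → β ⊑ γ → forget j β ⊑ forget j γ
  forget-mono {β} j β⊑γ = ⊑-forget j (⊑-trans (forget-⊑ j β) β⊑γ) (forget-self j β)

  InS-antitone : ∀ {β α : Fin n → T} a → β ⊑ α → InS a α → InS a β
  InS-antitone a β⊑α a∈Sα i βi≢u =
    trans (a∈Sα i (βi≢u ∘ trans (β⊑α i βi≢u))) (sym (β⊑α i βi≢u))

  InS-cong : ∀ {a b} (β : Fin n → T) → a ≗ b → InS a β → InS b β
  InS-cong β a≗b a∈Sβ i βi≢u = trans (cong embed (sym (a≗b i))) (a∈Sβ i βi≢u)

  ConstantOn : ((Fin n → Bool) → Bool) → Bool → (Fin n → T) → Set
  ConstantOn g ε β = ∀ a → InS a β → g a ≡ ε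

  ConstantOn-mono : ∀ g ε {β α : Fin n → T} → β ⊑ α → ConstantOn g ε β → ConstantOn g ε α
  ConstantOn-mono g ε β⊑α const a a∈Sα = const a (InS-antitone a β⊑α a∈Sα)

  ConstantOn-cong : ∀ {g h : (Fin n → Bool) → Bool} {ε β} →
                    g ≗ h → ConstantOn g ε β → ConstantOn h ε β
  ConstantOn-cong g≗h const a a∈Sβ = trans (sym (g≗h a)) (const a a∈Sβ)

termLit≡true⇔ : ∀ x b → termLit x b ≡ true ⇔ (x ≢ Tu → embed b ≡ x)
termLit≡true⇔ T0 false = mk⇔ (λ _ _ → refl) (λ _ → refl)
termLit≡true⇔ T0 true = mk⇔ (λ ()) (λ h → contradiction (h λ ()) λ ())
termLit≡true⇔ Tu b = mk⇔ (λ _ ne → contradiction refl ne) (λ _ → refl)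
termLit≡true⇔ T1 false = mk⇔ (λ ()) (λ h → contradiction (h λ ()) λ ())
termLit≡true⇔ T1 true = mk⇔ (λ _ _ → refl) (λ _ → refl)

clauseLit≡not-termLit : ∀ x b → clauseLit x b ≡ not (termLit x b)
clauseLit≡not-termLit T0 b = sym (not-involutive b)
clauseLit≡not-termLit Tu b = refl
clauseLit≡not-termLit T1 b = refl

module _ {n : ℕ} (β : Fin n → T) (a : Fin n → Bool) where

  termTrue⇔InS : termTrue β a ⇔ InS a β
  termTrue⇔InS = mk⇔
    (λ t i → Equivalence.to (termLit≡true⇔ (β i) (a i)) (t i))
    (λ s i → Equivalence.from (termLit≡true⇔ (β i) (a i)) (s i))

  termTrue? : Dec (termTrue β a)
  termTrue? = all? λ i → termLit (β i) (a i) ≟ᵇ true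

  clauseTrue⇔¬termTrue : clauseTrue β a ⇔ (¬ termTrue β a)
  clauseTrue⇔¬termTrue = mk⇔ clause⇒¬term ¬term⇒clause
    where
    clause⇒¬term : clauseTrue β a → ¬ termTrue β a
    clause⇒¬term (i , lit) t with () ←
      trans (sym lit) (trans (clauseLit≡not-termLit (β i) (a i)) (cong not (t i)))

    ¬term⇒clause : ¬ termTrue β a → clauseTrue β a
    ¬term⇒clause ¬t with ¬∀⟶∃¬ n _ (λ i → termLit (β i) (a i) ≟ᵇ true) ¬t
    ... | i , ¬lit = i , trans (clauseLit≡not-termLit (β i) (a i)) (cong not (¬-not ¬lit))

  InS? : Dec (InS a β)
  InS? = map′ (Equivalence.to termTrue⇔InS) (Equivalence.from termTrue⇔InS) termTrue?

ImplicantOf : ∀ {n} → Bool → ((Fin n → Bool) → Bool) → (Fin n → T) → Set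
ImplicantOf true f β = TermImplies β f
ImplicantOf false f β = ImpliesClause f β

ConstantOn⇔ImplicantOf : ∀ {n} (f : (Fin n → Bool) → Bool) ε β →
                          ConstantOn f ε β ⇔ ImplicantOf ε f β
ConstantOn⇔ImplicantOf f true β = mk⇔
  (λ const a t → const a (Equivalence.to (termTrue⇔InS β a) t))
  (λ imp a s → imp a (Equivalence.from (termTrue⇔InS β a) s))
ConstantOn⇔ImplicantOf f false β = mk⇔
  (λ const a fa≡1 → Equivalence.from (clauseTrue⇔¬termTrue β a) λ t →
     not-¬ (const a (Equivalence.to (termTrue⇔InS β a) t)) fa≡1)
  (λ imp a s → ¬-not λ fa≡1 →
     Equivalence.to (clauseTrue⇔¬termTrue β a) (imp a fa≡1) (Equivalence.from (termTrue⇔InS β a) s))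

-- Assignments are enumerated as vectors; g-cong stands in for function
-- extensionality when an assignment a is replaced by lookup (tabulate a).
ConstantOn? : ∀ {n} (g : (Fin n → Bool) → Bool) → (∀ {a b} → a ≗ b → g a ≡ g b) →
              ∀ ε β → Dec (ConstantOn g ε β)
ConstantOn? g g-cong ε β
  with anySubset? (λ s → InS? β (lookup s) ×-dec ¬? (g (lookup s) ≟ᵇ ε))
... | yes (s , s∈Sβ , gs≢ε) = no λ const → gs≢ε (const (lookup s) s∈Sβ)
... | no ¬counterexample = yes λ a a∈Sβ → decidable-stable (g a ≟ᵇ ε) λ ga≢ε →
        ¬counterexample (tabulate a , InS-cong β (sym ∘ lookup∘tabulate a) a∈Sβ ,
                         ga≢ε ∘ trans (sym (g-cong (lookup∘tabulate a))))

Minimal : ∀ {n} → ((Fin n → T) → Set) → (Fin n → T) → Set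
Minimal P β = ∀ β' → ProperSub β' β → ¬ P β'

Minimal-weaken : ∀ {n} {P Q : (Fin n → T) → Set} {β} →
                 (∀ {γ} → Q γ → P γ) → Minimal P β → Minimal Q β
Minimal-weaken Q⇒P minP β' β'⊏β = minP β' β'⊏β ∘ Q⇒P

module Minimise {n : ℕ} (P : (Fin n → T) → Set)
                (P-mono : ∀ {β α} → β ⊑ α → P β → P α) (P? : ∀ β → Dec (P β)) where

  Irreducible : Fin n → (Fin n → T) → Set
  Irreducible j β = β j ≢ Tu → ¬ P (forget j β)

  Irreducible-antitone : ∀ {β γ} j → β ⊑ γ → Irreducible j γ → Irreducible j β
  Irreducible-antitone j β⊑γ irr βj≢u =
    irr (βj≢u ∘ trans (β⊑γ j βj≢u)) ∘ P-mono (forget-mono j β⊑γ)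

  Reduct : (Fin n → T) → List (Fin n) → Set
  Reduct γ js = Σ (Fin n → T) λ β → β ⊑ γ × P β × All (λ j → Irreducible j β) js

  greedy : ∀ {γ} js → P γ → Reduct γ js
  greedy [] pγ = _ , ⊑-refl , pγ , []
  greedy {γ} (j ∷ js) pγ with P? (forget j γ)
  ... | yes pγ' with greedy js pγ'
  ...   | β , β⊑ , pβ , irr =
          β , ⊑-trans β⊑ (forget-⊑ j γ) , pβ ,
          (λ βj≢u → contradiction (trans (β⊑ j βj≢u) (forget-self j γ)) βj≢u) ∷ irr
  greedy {γ} (j ∷ js) pγ | no ¬pγ' with greedy js pγ
  ...   | β , β⊑ , pβ , irr = β , β⊑ , pβ , Irreducible-antitone j β⊑ (λ _ → ¬pγ') ∷ irr

  minimise : ∀ {α} → P α → Σ (Fin n → T) λ β → β ⊑ α × P β × Minimal P β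
  minimise pα with greedy (allFin n) pα
  ... | β , β⊑α , pβ , irr = β , β⊑α , pβ , λ { β' (β'⊑β , j , β'j≡u , βj≢u) pβ' →
          All-lookup irr (∈-allFin j) βj≢u (P-mono (⊑-forget j β'⊑β β'j≡u) pβ') }

primeWitness : ∀ {n} ε (f : (Fin n → Bool) → Bool) {β} →
               ImplicantOf ε f β → Minimal (ImplicantOf ε f) β → PrimeWitness ε f β
primeWitness true f imp min = imp , min
primeWitness false f imp min = imp , min

proposition2 : (n : ℕ) (F : Circuit n) (f : (Fin n → Bool) → Bool) (ε : Bool) →
    Computes F f →
    HasHazard F ε →
    Σ (Fin n → T) λ α → PrimeWitness ε f α × HazardAt F ε α
proposition2 n F f ε computes (α , constα , Fα≡u) with minimise constα
  where open Minimise (ConstantOn (evalB F) ε) (ConstantOn-mono (evalB F) ε)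
                      (ConstantOn? (evalB F) (evalB-cong F) ε)
... | β , β⊑α , constβ , minβ = β , primeWitness ε f implicant minimal , constβ , Fβ≡u
  where
  implicant : ImplicantOf ε f β
  implicant = Equivalence.to (ConstantOn⇔ImplicantOf f ε β) (ConstantOn-cong computes constβ)

  minimal : Minimal (ImplicantOf ε f) β
  minimal = Minimal-weaken (λ {γ} imp → ConstantOn-cong (sym ∘ computes)
                              (Equivalence.from (ConstantOn⇔ImplicantOf f ε γ) imp)) minβ

  Fβ≡u : evalT F β ≡ Tu
  Fβ≡u = ≼Tu⇒≡Tu (subst (evalT F β ≼_) Fα≡u (evalT-mono F (⊑⇒≼ β⊑α)))
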